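{- For every partition $\lambda=(\lambda_1\ge\dots\ge\lambda_n\ge0)$, $$K_\lambda(\xi)=\det\big(K_{(\lambda_i+j-i,0,\dots,0)}(\xi)\big)_{i,j=1}^n,$$ where the sequence in the $(i,j)$ entry has exactly $n-j$ zeros.
   Context: Fix generic complex parameters $a,b,c,d,q,\xi$. For integers $n\ge0$ define $\mathcal{A}_n=\frac{(1-q^{n-1}abcd)(1-q^{n+1})(1-q^nab)(1-q^nac)(1-q^nad)(1-q^nbc)(1-q^nbd)(1-q^ncd)}{(1-q^{2n-1}abcd)(1-q^{2n}abcd)^2(1-q^{2n+1}abcd)}$, $d_n^\natural=\frac{q^{n-1}}{(1-q^{2n-2}abcd)(1-q^{2n}abcd)}\big[bd(a+c)+(b+d)q-abcd(b+d)q^{n-1}-\{bd(a+c)+abcd(b+d)\}q^n-bd(a+c)q^{n+1}+ab^2cd^2(a+c)q^{2n-1}+abcd(b+d)q^{2n}\big]$, $e_n^\natural=\frac{q^{n-1}}{(1-q^{2n-2}abcd)(1-q^{2n}abcd)}\big[ac(b+d)+(a+c)q-abcd(a+c)q^{n-1}-\{ac(b+d)+abcd(a+c)\}q^n-ac(b+d)q^{n+1}+a^2bc^2d(b+d)q^{2n-1}+abcd(a+c)q^{2n}\big]$, $d_n^\sharp=1$, $d_n^\flat=-\frac{q^nbd}{(1-q^nac)(1-q^nbd)}\mathcal{A}_n$, $e_n^\sharp=-q^nac$, $e_n^\flat=\frac{\mathcal{A}_n}{(1-q^nac)(1-q^nbd)}$. Let $\mathsf d,\mathsf e$ be the infinite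 tridiagonal matrices indexed by $\{0,1,\dots\}$ with nonzero entries $\mathsf d_{n,n}=d_n^\natural$, $\mathsf d_{n,n+1}=d_n^\sharp$, $\mathsf d_{n+1,n}=d_n^\flat$, and similarly for $\mathsf e$. Put $D=\frac{1}{1-q}(I+\mathsf d)$, $E=\frac{1}{1-q}(I+\mathsf e)$, $\langle W|=(1,0,0,\dots)$, $|V\rangle=\langle W|^T$, and $Z_k(\xi)=\langle W|(\xi D+E)^k|V\rangle$. For an integer sequence $\mu=(\mu_1,\dots,\mu_p)$ with $\mu_i+p-i\ge0$ for all $i$, define $$K_\mu(\xi)=\frac{\det\big(Z_{\mu_i+p-i+p-j}(\xi)\big)_{i,j=1}^p}{\det\big(Z_{2p-i-j}(\xi)\big)_{i,j=1}^p}.$$ -}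

module Defs where

open import Level using (Level; _⊔_) renaming (suc to lsuc)
open import Algebra.Bundles using (CommutativeRing)
open import Data.Nat as ℕ using (ℕ; zero; suc)
open import Data.Integer as ℤ using (ℤ; +_; -[1+_])
open import Data.Fin as Fin using (Fin; zero; suc; toℕ; punchIn)
open import Relation.Nullary using (¬_)

record DField (c ℓ : Level) : Set (lsuc (c ⊔ ℓ)) where
  field
    commutativeRing : CommutativeRing c ℓ
  open CommutativeRing commutativeRing public
  field
    _⁻¹     : Carrier → Carrier
    1≉0     : ¬ (1# ≈ 0#)
    ⁻¹-inverse : ∀ x → ¬ (x ≈ 0#) → x * (x ⁻¹) ≈ 1#

CharZero : ∀ {c ℓ} → DField c ℓ → Set ℓ
CharZero F = ∀ (n : ℕ) → ¬ (fromℕ (suc n) ≈ 0#)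
  where
  open DField F using (Carrier; _≈_; _+_; 0#; 1#)
  fromℕ : ℕ → Carrier
  fromℕ zero = 0#
  fromℕ (suc n) = 1# + fromℕ n

module Theory {c ℓ} (F : DField c ℓ) where
  open DField F using (Carrier; _≈_; _+_; _*_; -_; _-_; 0#; 1#; _⁻¹)

  _/_ : Carrier → Carrier → Carrier
  x / y = x * (y ⁻¹)

  infixr 8 _^_
  _^_ : Carrier → ℕ → Carrier
  x ^ zero = 1#
  x ^ suc n = x * (x ^ n)

  _^ℤ_ : Carrier → ℤ → Carrier
  x ^ℤ (+ n) = x ^ n
  x ^ℤ -[1+ n ] = (x ⁻¹) ^ suc n

  ΣFin : (n : ℕ) → (Fin n → Carrier) → Carrier
  ΣFin zero f = 0#
  ΣFin (suc n) f = f zero + ΣFin n (λ i → f (suc i))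

  sgn : ℕ → Carrier
  sgn zero = 1#
  sgn (suc k) = - sgn k

  det : (n : ℕ) → (Fin n → Fin n → Carrier) → Carrier
  det zero A = 1#
  det (suc n) A =
    ΣFin (suc n) (λ j → sgn (toℕ j) * (A zero j * det n (λ r s → A (suc r) (punchIn j s))))

  -- Tridiagonal infinite matrices indexed by ℕ:
  -- entry (n,n) = diag n, entry (n,n+1) = sup n, entry (n+1,n) = sub n, all others 0.
  record Tri : Set c where
    constructor tri
    field
      diag sup sub : ℕ → Carrier
  open Tri public

  triAdd : Tri → Tri → Tri
  triAdd M N = tri (λ n → diag M n + diag N n) (λ n → sup M n + sup N n) (λ n → sub M n + sub N n)

  triScale : Carrier → Tri → Tri
  triScale x M = tri (λ n → x * diag M n) (λ n → x * sup M n) (λ n → x * sub M n)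

  -- row vector (indexed by ℕ) times a tridiagonal matrix:
  -- (v M)_m = Σ_n v_n M_{n,m} = v_{m-1} M_{m-1,m} + v_m M_{m,m} + v_{m+1} M_{m+1,m}
  rowMul : (ℕ → Carrier) → Tri → (ℕ → Carrier)
  rowMul v M zero = v zero * diag M zero + v 1 * sub M zero
  rowMul v M (suc m) = v m * sup M m + (v (suc m) * diag M (suc m) + v (suc (suc m)) * sub M (suc m))

  W : ℕ → Carrier
  W zero = 1#
  W (suc _) = 0#

  rowPow : Tri → ℕ → (ℕ → Carrier)
  rowPow M zero = W
  rowPow M (suc k) = rowMul (rowPow M k) M

  -- ⟨W| M^k |V⟩ = 0-th component of ⟨W| M^k
  corner : Tri → ℕ → Carrier
  corner M k = rowPow M k zero

  module Model (a b c d q : Carrier) where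
    abcd : Carrier
    abcd = a * b * c * d

    Q : ℤ → Carrier
    Q m = q ^ℤ m

    z : ℕ → ℤ
    z n = + n

    𝒜 : ℕ → Carrier
    𝒜 n =
      ((1# - Q (z n ℤ.- + 1) * abcd) * (1# - q ^ suc n) * (1# - q ^ n * (a * b))
        * (1# - q ^ n * (a * c)) * (1# - q ^ n * (a * d)) * (1# - q ^ n * (b * c))
        * (1# - q ^ n * (b * d)) * (1# - q ^ n * (c * d)))
      / ((1# - Q (+ 2 ℤ.* z n ℤ.- + 1) * abcd) * ((1# - q ^ (2 ℕ.* n) * abcd) * (1# - q ^ (2 ℕ.* n) * abcd))
          * (1# - q ^ (suc (2 ℕ.* n)) * abcd))

    pre : ℕ → Carrier
    pre n = Q (z n ℤ.- + 1) / ((1# - Q (+ 2 ℤ.* z n ℤ.- + 2) * abcd) * (1# - q ^ (2 ℕ.* n) * abcd))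

    d♮ : ℕ → Carrier
    d♮ n = pre n *
      (b * d * (a + c) + (b + d) * q
       - abcd * (b + d) * Q (z n ℤ.- + 1)
       - (b * d * (a + c) + abcd * (b + d)) * q ^ n
       - b * d * (a + c) * q ^ suc n
       + a * (b * b) * c * (d * d) * (a + c) * Q (+ 2 ℤ.* z n ℤ.- + 1)
       + abcd * (b + d) * q ^ (2 ℕ.* n))

    e♮ : ℕ → Carrier
    e♮ n = pre n *
      (a * c * (b + d) + (a + c) * q
       - abcd * (a + c) * Q (z n ℤ.- + 1)
       - (a * c * (b + d) + abcd * (a + c)) * q ^ n
       - a * c * (b + d) * q ^ suc n
       + (a * a) * b * (c * c) * d * (b + d) * Q (+ 2 ℤ.* z n ℤ.- + 1)
       + abcd * (a + c) * q ^ (2 ℕ.* n))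

    d♯ d♭ e♯ e♭ : ℕ → Carrier
    d♯ n = 1#
    d♭ n = - ((q ^ n * (b * d)) / ((1# - q ^ n * (a * c)) * (1# - q ^ n * (b * d)))) * 𝒜 n
    e♯ n = - (q ^ n * (a * c))
    e♭ n = 𝒜 n / ((1# - q ^ n * (a * c)) * (1# - q ^ n * (b * d)))

    Id : Tri
    Id = tri (λ _ → 1#) (λ _ → 0#) (λ _ → 0#)

    𝖽 𝖾 : Tri
    𝖽 = tri d♮ d♯ d♭
    𝖾 = tri e♮ e♯ e♭

    D E : Tri
    D = triScale ((1# - q) ⁻¹) (triAdd Id 𝖽)
    E = triScale ((1# - q) ⁻¹) (triAdd Id 𝖾)

    Z : Carrier → ℕ → Carrier
    Z ξ k = corner (triAdd (triScale ξ D) E) k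

    -- Z at an integer index (only used at nonnegative indices; junk value 0 otherwise)
    Zℤ : Carrier → ℤ → Carrier
    Zℤ ξ (+ k) = Z ξ k
    Zℤ ξ -[1+ _ ] = 0#

    -- Hankel determinant det(Z_{2p-i-j})_{i,j=1..p}; with 0-based i,j: index (p-1-i)+(p-1-j)
    hankel : Carrier → ℕ → Carrier
    hankel ξ p = det p (λ i j → Z ξ ((p ℕ.∸ suc (toℕ i)) ℕ.+ (p ℕ.∸ suc (toℕ j))))

    -- K_μ(ξ) for μ = (μ_1,…,μ_p) (0-based: μ i); entry index μ_i + (p-i) + (p-j) in 1-based form
    K : Carrier → (p : ℕ) → (Fin p → ℤ) → Carrier
    K ξ p μ =
      det p (λ i j → Zℤ ξ (μ i ℤ.+ + ((p ℕ.∸ suc (toℕ i)) ℕ.+ (p ℕ.∸ suc (toℕ j)))))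
        / hankel ξ p

    headSeq : (p : ℕ) → ℤ → Fin p → ℤ
    headSeq p m zero = m
    headSeq p m (suc _) = + 0

IsPartition : (n : ℕ) → (Fin n → ℕ) → Set
IsPartition n λ' = ∀ (i j : Fin n) → toℕ i ℕ.≤ toℕ j → λ' j ℕ.≤ λ' i

module Submission where

-- Expanding the numerator of K_(m,0,…,0) (p parts) along its first row, the only
-- row depending on m, gives K_(m,0,…,0) = (H_{p−1}/H_p) Z_{m+2p−2} + Σ_{s≥1} c_s Z_{m+2p−2−s},
-- where H_p is the Hankel determinant and the c_s do not depend on m. So column j of
-- the right-hand matrix is H_{n−1−j}/H_{n−j} times column j of the numerator matrix
-- of K_λ plus a combination of later columns, and column operations give its
-- determinant as ∏_j H_{n−1−j}/H_{n−j} · det(numerator) = det(numerator)/H_n = K_λ.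
-- This holds for any sequence Z as soon as H_0, …, H_n ≠ 0.

open import Defs
open import Level using (Level)
open import Data.Nat as ℕ using (ℕ; _≤_; _∸_)
open import Data.Integer as ℤ using (ℤ; +_)
open import Data.Fin using (Fin; toℕ)
open import Relation.Nullary using (¬_)

open import Data.Nat using (zero; suc; _<_; _<?_; z≤n; s≤s; s≤s⁻¹)
import Data.Nat.Properties as ℕₚ
import Data.Integer.Properties as ℤₚ
import Data.Integer.Tactic.RingSolver as ℤ-Solver
open import Data.Fin using (zero; suc; inject₁; punchIn; punchOut; fromℕ<; _≟_)
open import Data.Fin.Properties
  using (toℕ-inject₁; toℕ-fromℕ<; toℕ<n; toℕ-injective; suc-injective;
         punchIn-injective; punchInᵢ≢i; punchIn-punchOut)
open import Data.Product as Product using (∃; _×_; _,_)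
open import Data.Sum as Sum using (_⊎_; inj₁; inj₂)
open import Function using (_∘_)
open import Relation.Nullary using (yes; no; contradiction)
open import Relation.Binary.Definitions using (tri<; tri≈; tri>)
open import Relation.Binary.PropositionalEquality as ≡ using (_≡_; _≢_)

punchIn-onto-adjacentPair : ∀ {n} (j : Fin (suc (suc n))) (k : Fin (suc n)) →
  j ≢ inject₁ k → j ≢ suc k →
  ∃ λ k′ → punchIn j (inject₁ k′) ≡ inject₁ k × punchIn j (suc k′) ≡ suc k
punchIn-onto-adjacentPair zero zero j≢k _ = contradiction ≡.refl j≢k
punchIn-onto-adjacentPair zero (suc k) _ _ = k , ≡.refl , ≡.refl
punchIn-onto-adjacentPair (suc zero) zero _ j≢k+1 = contradiction ≡.refl j≢k+1
punchIn-onto-adjacentPair {suc n} (suc (suc j)) zero _ _ = zero , ≡.refl , ≡.refl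
punchIn-onto-adjacentPair {suc n} (suc j) (suc k) j≢k j≢k+1 =
  Product.map suc (Product.map (≡.cong suc) (≡.cong suc))
    (punchIn-onto-adjacentPair j k (j≢k ∘ ≡.cong suc) (j≢k+1 ∘ ≡.cong suc))

punchIn-adjacentPair : ∀ {n} (k s : Fin n) →
  punchIn (inject₁ k) s ≡ punchIn (suc k) s
  ⊎ (punchIn (inject₁ k) s ≡ suc k × punchIn (suc k) s ≡ inject₁ k)
punchIn-adjacentPair zero    zero    = inj₂ (≡.refl , ≡.refl)
punchIn-adjacentPair zero    (suc s) = inj₁ ≡.refl
punchIn-adjacentPair (suc k) zero    = inj₁ ≡.refl
punchIn-adjacentPair (suc k) (suc s) =
  Sum.map (≡.cong suc) (Product.map (≡.cong suc) (≡.cong suc)) (punchIn-adjacentPair k s)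

inject₁≢suc : ∀ {n} (k : Fin n) → inject₁ k ≢ suc k
inject₁≢suc zero    ()
inject₁≢suc (suc k) = inject₁≢suc k ∘ suc-injective

module Determinant {c ℓ} (F : DField c ℓ) where
  open DField F hiding (zero)
  open Theory F using (ΣFin; sgn; det)
  open import Algebra.Properties.Ring ring
    using (-‿distribˡ-*; -‿involutive; -0#≈0#; +-inverseʳ-unique)
  open import Algebra.Solver.Ring.NaturalCoefficients.Default commutativeSemiring
  open import Relation.Binary.Reasoning.Setoid setoid

  Matrix : ℕ → Set c
  Matrix n = Fin n → Fin n → Carrier

  column : ∀ {n} → Matrix n → Fin n → Fin n → Carrier
  column A k i = A i k

  ΣFin-cong : ∀ n {f g : Fin n → Carrier} → (∀ i → f i ≈ g i) → ΣFin n f ≈ ΣFin n g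
  ΣFin-cong zero    f≈g = refl
  ΣFin-cong (suc n) f≈g = +-cong (f≈g zero) (ΣFin-cong n (f≈g ∘ suc))

  ΣFin-zero : ∀ n {f : Fin n → Carrier} → (∀ i → f i ≈ 0#) → ΣFin n f ≈ 0#
  ΣFin-zero zero    f≈0 = refl
  ΣFin-zero (suc n) f≈0 = trans (+-cong (f≈0 zero) (ΣFin-zero n (f≈0 ∘ suc))) (+-identityˡ 0#)

  ΣFin-linear : ∀ n x y (f g : Fin n → Carrier) →
    ΣFin n (λ i → x * f i + y * g i) ≈ x * ΣFin n f + y * ΣFin n g
  ΣFin-linear zero    x y f g = sym (trans (+-cong (zeroʳ x) (zeroʳ y)) (+-identityˡ 0#))
  ΣFin-linear (suc n) x y f g = begin
    (x * f zero + y * g zero) + ΣFin n (λ i → x * f (suc i) + y * g (suc i))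
      ≈⟨ +-congˡ (ΣFin-linear n x y (f ∘ suc) (g ∘ suc)) ⟩
    (x * f zero + y * g zero) + (x * ΣFin n (f ∘ suc) + y * ΣFin n (g ∘ suc))
      ≈⟨ solve 6 (λ x y a b A B → (x :* a :+ y :* b) :+ (x :* A :+ y :* B)
                                  := x :* (a :+ A) :+ y :* (b :+ B))
               refl x y (f zero) (g zero) (ΣFin n (f ∘ suc)) (ΣFin n (g ∘ suc)) ⟩
    x * (f zero + ΣFin n (f ∘ suc)) + y * (g zero + ΣFin n (g ∘ suc)) ∎

  ΣFin-*ʳ : ∀ n (f : Fin n → Carrier) x → ΣFin n f * x ≈ ΣFin n (λ s → f s * x)
  ΣFin-*ʳ zero    f x = zeroˡ x
  ΣFin-*ʳ (suc n) f x = trans (distribʳ x _ _) (+-congˡ (ΣFin-*ʳ n (f ∘ suc) x))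

  ΣFin-adjacentPair : ∀ n (f : Fin (suc n) → Carrier) (k : Fin n) →
    (∀ j → j ≢ inject₁ k → j ≢ suc k → f j ≈ 0#) →
    f (inject₁ k) + f (suc k) ≈ 0# → ΣFin (suc n) f ≈ 0#
  ΣFin-adjacentPair (suc n) f zero rest≈0 pair≈0 = begin
    f zero + (f (suc zero) + ΣFin n (λ i → f (suc (suc i)))) ≈⟨ +-assoc _ _ _ ⟨
    (f zero + f (suc zero)) + ΣFin n (λ i → f (suc (suc i)))
      ≈⟨ +-cong pair≈0 (ΣFin-zero n (λ i → rest≈0 (suc (suc i)) (λ ()) (λ ()))) ⟩
    0# + 0#                                            ≈⟨ +-identityˡ 0# ⟩
    0#                                                 ∎
  ΣFin-adjacentPair (suc n) f (suc k) rest≈0 pair≈0 =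
    trans (+-cong (rest≈0 zero (λ ()) (λ ()))
                  (ΣFin-adjacentPair n (f ∘ suc) k
                     (λ j p q → rest≈0 (suc j) (p ∘ suc-injective) (q ∘ suc-injective))
                     pair≈0))
          (+-identityˡ 0#)

  minor : ∀ {n} → Matrix (suc n) → Fin (suc n) → Matrix n
  minor A j r s = A (suc r) (punchIn j s)

  laplaceTerm : ∀ {n} → Matrix (suc n) → Fin (suc n) → Carrier
  laplaceTerm {n} A j = sgn (toℕ j) * (A zero j * det n (minor A j))

  det-cong : ∀ n {A B : Matrix n} → (∀ i j → A i j ≈ B i j) → det n A ≈ det n B
  det-cong zero    A≈B = refl
  det-cong (suc n) A≈B = ΣFin-cong (suc n) λ j →
    *-congˡ {sgn (toℕ j)} (*-cong (A≈B zero j) (det-cong n (λ r s → A≈B (suc r) (punchIn j s))))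

  SameOutsideColumn : ∀ {n} → Fin n → Matrix n → Matrix n → Set ℓ
  SameOutsideColumn k A B = ∀ i j → j ≢ k → A i j ≈ B i j

  det-linearInColumn : ∀ n (A B C : Matrix n) (k : Fin n) x y →
    (∀ i → A i k ≈ x * B i k + y * C i k) →
    SameOutsideColumn k A B → SameOutsideColumn k A C →
    det n A ≈ x * det n B + y * det n C
  det-linearInColumn (suc n) A B C k x y colₖ A~B A~C =
    trans (ΣFin-cong (suc n) termwise) (ΣFin-linear (suc n) x y (laplaceTerm B) (laplaceTerm C))
    where
    termwise : ∀ j → laplaceTerm A j ≈ x * laplaceTerm B j + y * laplaceTerm C j
    termwise j with j ≟ k
    ... | yes ≡.refl = begin
      sgn (toℕ j) * (A zero j * det n (minor A j))
        ≈⟨ *-congˡ (*-cong (colₖ zero) minorB) ⟩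
      sgn (toℕ j) * ((x * B zero j + y * C zero j) * det n (minor B j))
        ≈⟨ solve 6 (λ s x y b c m → s :* ((x :* b :+ y :* c) :* m)
                                    := x :* (s :* (b :* m)) :+ y :* (s :* (c :* m)))
                 refl (sgn (toℕ j)) x y (B zero j) (C zero j) (det n (minor B j)) ⟩
      x * laplaceTerm B j + y * (sgn (toℕ j) * (C zero j * det n (minor B j)))
        ≈⟨ +-congˡ (*-congˡ (*-congˡ (*-congˡ (trans (sym minorB) minorC)))) ⟩
      x * laplaceTerm B j + y * laplaceTerm C j ∎
      where
      minorB : det n (minor A j) ≈ det n (minor B j)
      minorB = det-cong n (λ r s → A~B (suc r) (punchIn j s) (punchInᵢ≢i j s))
      minorC : det n (minor A j) ≈ det n (minor C j)
      minorC = det-cong n (λ r s → A~C (suc r) (punchIn j s) (punchInᵢ≢i j s))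
    ... | no j≢k = begin
      sgn (toℕ j) * (A zero j * det n (minor A j))
        ≈⟨ *-congˡ (*-congˡ minors) ⟩
      sgn (toℕ j) * (A zero j * (x * det n (minor B j) + y * det n (minor C j)))
        ≈⟨ solve 6 (λ s a x y b c → s :* (a :* (x :* b :+ y :* c))
                                    := x :* (s :* (a :* b)) :+ y :* (s :* (a :* c)))
                 refl (sgn (toℕ j)) (A zero j) x y (det n (minor B j)) (det n (minor C j)) ⟩
      x * (sgn (toℕ j) * (A zero j * det n (minor B j)))
        + y * (sgn (toℕ j) * (A zero j * det n (minor C j)))
        ≈⟨ +-cong (*-congˡ (*-congˡ (*-congʳ (A~B zero j j≢k))))
                  (*-congˡ (*-congˡ (*-congʳ (A~C zero j j≢k)))) ⟩
      x * laplaceTerm B j + y * laplaceTerm C j ∎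
      where
      k′ : Fin n
      k′ = punchOut j≢k
      punchIn≡k : punchIn j k′ ≡ k
      punchIn≡k = punchIn-punchOut j≢k
      avoids : ∀ s → s ≢ k′ → punchIn j s ≢ k
      avoids s s≢k′ eq = s≢k′ (punchIn-injective j s k′ (≡.trans eq (≡.sym punchIn≡k)))
      minors : det n (minor A j) ≈ x * det n (minor B j) + y * det n (minor C j)
      minors = det-linearInColumn n (minor A j) (minor B j) (minor C j) k′ x y
        (λ r → ≡.subst (λ t → A (suc r) t ≈ x * B (suc r) t + y * C (suc r) t)
                       (≡.sym punchIn≡k) (colₖ (suc r)))
        (λ r s s≢k′ → A~B (suc r) (punchIn j s) (avoids s s≢k′))
        (λ r s s≢k′ → A~C (suc r) (punchIn j s) (avoids s s≢k′))

  det-additiveInColumn : ∀ n (A B C : Matrix n) (k : Fin n) →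
    (∀ i → A i k ≈ B i k + C i k) →
    SameOutsideColumn k A B → SameOutsideColumn k A C →
    det n A ≈ det n B + det n C
  det-additiveInColumn n A B C k colₖ A~B A~C =
    trans (det-linearInColumn n A B C k 1# 1# (λ i → trans (colₖ i) (sym one*+one*)) A~B A~C)
          one*+one*
    where
    one*+one* : ∀ {u v} → 1# * u + 1# * v ≈ u + v
    one*+one* = +-cong (*-identityˡ _) (*-identityˡ _)

  det-adjacentEqualColumns : ∀ n (A : Matrix (suc n)) (k : Fin n) →
    (∀ i → A i (inject₁ k) ≈ A i (suc k)) → det (suc n) A ≈ 0#
  det-adjacentEqualColumns (suc n) A k cols≈ =
    ΣFin-adjacentPair (suc n) (laplaceTerm A) k offPair≈0 pair≈0
    where
    offPair≈0 : ∀ j → j ≢ inject₁ k → j ≢ suc k → laplaceTerm A j ≈ 0#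
    offPair≈0 j j≢k j≢k+1 with punchIn-onto-adjacentPair j k j≢k j≢k+1
    ... | k′ , eq₁ , eq₂ = begin
      sgn (toℕ j) * (A zero j * det (suc n) (minor A j))
        ≈⟨ *-congˡ (*-congˡ (det-adjacentEqualColumns n (minor A j) k′ λ r →
             trans (reflexive (≡.cong (A (suc r)) eq₁))
                   (trans (cols≈ (suc r)) (reflexive (≡.cong (A (suc r)) (≡.sym eq₂)))))) ⟩
      sgn (toℕ j) * (A zero j * 0#)  ≈⟨ trans (*-congˡ (zeroʳ _)) (zeroʳ _) ⟩
      0#                             ∎
    minors≈ : ∀ r s → minor A (inject₁ k) r s ≈ minor A (suc k) r s
    minors≈ r s with punchIn-adjacentPair k s
    ... | inj₁ eq = reflexive (≡.cong (A (suc r)) eq)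
    ... | inj₂ (eq₁ , eq₂) = trans (reflexive (≡.cong (A (suc r)) eq₁))
      (trans (sym (cols≈ (suc r))) (reflexive (≡.cong (A (suc r)) (≡.sym eq₂))))
    t : Carrier
    t = sgn (toℕ k) * (A zero (inject₁ k) * det (suc n) (minor A (inject₁ k)))
    pair≈0 : laplaceTerm A (inject₁ k) + laplaceTerm A (suc k) ≈ 0#
    pair≈0 = begin
      laplaceTerm A (inject₁ k) + - sgn (toℕ k) * (A zero (suc k) * det (suc n) (minor A (suc k)))
        ≈⟨ +-cong (*-congʳ (reflexive (≡.cong sgn (toℕ-inject₁ k))))
                  (*-congˡ (*-cong (sym (cols≈ zero)) (sym (det-cong (suc n) minors≈)))) ⟩
      t + - sgn (toℕ k) * (A zero (inject₁ k) * det (suc n) (minor A (inject₁ k)))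
        ≈⟨ +-congˡ (-‿distribˡ-* _ _) ⟨
      t + - t  ≈⟨ -‿inverseʳ t ⟩
      0#       ∎

  replaceColumn : ∀ {n} → Matrix n → Fin n → (Fin n → Carrier) → Matrix n
  replaceColumn A k v i j with j ≟ k
  ... | yes _ = v i
  ... | no  _ = A i j

  replaceColumn-≡ : ∀ {n} (A : Matrix n) k v i → replaceColumn A k v i k ≡ v i
  replaceColumn-≡ A k v i with k ≟ k
  ... | yes _   = ≡.refl
  ... | no  k≢k = contradiction ≡.refl k≢k

  replaceColumn-≢ : ∀ {n} (A : Matrix n) k v i j → j ≢ k → replaceColumn A k v i j ≡ A i j
  replaceColumn-≢ A k v i j j≢k with j ≟ k
  ... | yes j≡k = contradiction j≡k j≢k
  ... | no  _   = ≡.refl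

  replaceColumn-column : ∀ {n} (A : Matrix n) k i j → replaceColumn A k (column A k) i j ≡ A i j
  replaceColumn-column A k i j with j ≟ k
  ... | yes ≡.refl = ≡.refl
  ... | no  _      = ≡.refl

  replaceAdjacentColumns : ∀ {n} → Matrix (suc n) → Fin n → (u v : Fin (suc n) → Carrier) →
    Matrix (suc n)
  replaceAdjacentColumns A k u v i j with j ≟ inject₁ k
  ... | yes _ = u i
  ... | no  _ = replaceColumn A (suc k) v i j

  module _ {n} (A : Matrix (suc n)) (k : Fin n) where

    replaceAdjacentColumns-inject₁ : ∀ u v i → replaceAdjacentColumns A k u v i (inject₁ k) ≡ u i
    replaceAdjacentColumns-inject₁ u v i with inject₁ k ≟ inject₁ k
    ... | yes _   = ≡.refl
    ... | no  k≢k = contradiction ≡.refl k≢k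

    replaceAdjacentColumns-suc : ∀ u v i → replaceAdjacentColumns A k u v i (suc k) ≡ v i
    replaceAdjacentColumns-suc u v i with suc k ≟ inject₁ k
    ... | yes eq = contradiction (≡.sym eq) (inject₁≢suc k)
    ... | no  _  = replaceColumn-≡ A (suc k) v i

    replaceAdjacentColumns-≢ : ∀ u v i j → j ≢ inject₁ k → j ≢ suc k →
      replaceAdjacentColumns A k u v i j ≡ A i j
    replaceAdjacentColumns-≢ u v i j j≢k j≢k+1 with j ≟ inject₁ k
    ... | yes eq = contradiction eq j≢k
    ... | no  _  = replaceColumn-≢ A (suc k) v i j j≢k+1

    replaceAdjacentColumns-own :
      ∀ i j → replaceAdjacentColumns A k (column A (inject₁ k)) (column A (suc k)) i j ≡ A i j
    replaceAdjacentColumns-own i j with j ≟ inject₁ k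
    ... | yes ≡.refl = ≡.refl
    ... | no  _      = replaceColumn-column A (suc k) i j

    replaceAdjacentColumns-outside-inject₁ : ∀ u v w →
      SameOutsideColumn (inject₁ k) (replaceAdjacentColumns A k u w) (replaceAdjacentColumns A k v w)
    replaceAdjacentColumns-outside-inject₁ u v w i j j≢k with j ≟ inject₁ k
    ... | yes eq = contradiction eq j≢k
    ... | no  _  = refl

    replaceAdjacentColumns-outside-suc : ∀ u v w →
      SameOutsideColumn (suc k) (replaceAdjacentColumns A k u v) (replaceAdjacentColumns A k u w)
    replaceAdjacentColumns-outside-suc u v w i j j≢k+1 with j ≟ inject₁ k
    ... | yes _ = refl
    ... | no  _ = reflexive (≡.trans (replaceColumn-≢ A (suc k) v i j j≢k+1)
                                     (≡.sym (replaceColumn-≢ A (suc k) w i j j≢k+1)))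

  -- The swap is reduced to the adjacent equal-column case through
  -- 0 = det(a+b, a+b) = det(a, a) + det(a, b) + det(b, a) + det(b, b).
  det-swapAdjacentColumns : ∀ n (A : Matrix (suc n)) (k : Fin n) →
    det (suc n) (replaceAdjacentColumns A k (column A (suc k)) (column A (inject₁ k)))
      ≈ - det (suc n) A
  det-swapAdjacentColumns n A k = +-inverseʳ-unique (det (suc n) A) (det (suc n) (P b a)) sum≈0
    where
    P : (u v : Fin (suc n) → Carrier) → Matrix (suc n)
    P = replaceAdjacentColumns A k
    a b : Fin (suc n) → Carrier
    a = column A (inject₁ k)
    b = column A (suc k)
    a+b : Fin (suc n) → Carrier
    a+b i = a i + b i
    det-P-equal : ∀ u → det (suc n) (P u u) ≈ 0#
    det-P-equal u = det-adjacentEqualColumns n (P u u) k λ i →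
      reflexive (≡.trans (replaceAdjacentColumns-inject₁ A k u u i)
                         (≡.sym (replaceAdjacentColumns-suc A k u u i)))
    split₁ : det (suc n) (P a+b a+b) ≈ det (suc n) (P a a+b) + det (suc n) (P b a+b)
    split₁ = det-additiveInColumn (suc n) _ _ _ (inject₁ k)
      (λ i → reflexive (≡.trans (replaceAdjacentColumns-inject₁ A k a+b a+b i)
        (≡.sym (≡.cong₂ _+_ (replaceAdjacentColumns-inject₁ A k a a+b i)
                            (replaceAdjacentColumns-inject₁ A k b a+b i)))))
      (replaceAdjacentColumns-outside-inject₁ A k a+b a a+b)
      (replaceAdjacentColumns-outside-inject₁ A k a+b b a+b)
    split₂ : ∀ u → det (suc n) (P u a+b) ≈ det (suc n) (P u a) + det (suc n) (P u b)
    split₂ u = det-additiveInColumn (suc n) _ _ _ (suc k)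
      (λ i → reflexive (≡.trans (replaceAdjacentColumns-suc A k u a+b i)
        (≡.sym (≡.cong₂ _+_ (replaceAdjacentColumns-suc A k u a i)
                            (replaceAdjacentColumns-suc A k u b i)))))
      (replaceAdjacentColumns-outside-suc A k u a+b a)
      (replaceAdjacentColumns-outside-suc A k u a+b b)
    sum≈0 : det (suc n) A + det (suc n) (P b a) ≈ 0#
    sum≈0 = begin
      det (suc n) A + det (suc n) (P b a)
        ≈⟨ +-cong (+-identityˡ _) (+-identityʳ _) ⟨
      (0# + det (suc n) A) + (det (suc n) (P b a) + 0#)
        ≈⟨ +-cong (+-cong (det-P-equal a)
                          (det-cong (suc n) (λ i j → reflexive (replaceAdjacentColumns-own A k i j))))
                  (+-congˡ (det-P-equal b)) ⟨
      (det (suc n) (P a a) + det (suc n) (P a b)) + (det (suc n) (P b a) + det (suc n) (P b b))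
        ≈⟨ +-cong (split₂ a) (split₂ b) ⟨
      det (suc n) (P a a+b) + det (suc n) (P b a+b)  ≈⟨ split₁ ⟨
      det (suc n) (P a+b a+b)                        ≈⟨ det-P-equal a+b ⟩
      0#                                             ∎

  -- Induction on d: an adjacent swap moves the equal column suc e one step towards k.
  det-equalColumnsAtDistance : ∀ d {n} (A : Matrix (suc n)) (k : Fin (suc n)) (e : Fin n) →
    toℕ e ≡ d ℕ.+ toℕ k → (∀ i → A i k ≈ A i (suc e)) → det (suc n) A ≈ 0#
  det-equalColumnsAtDistance zero {n} A k e e≡k cols≈ =
    det-adjacentEqualColumns n A e
      (≡.subst (λ t → ∀ i → A i t ≈ A i (suc e)) (≡.sym inject₁e≡k) cols≈)
    where
    inject₁e≡k : inject₁ e ≡ k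
    inject₁e≡k = toℕ-injective (≡.trans (toℕ-inject₁ e) e≡k)
  det-equalColumnsAtDistance (suc d) {suc n} A k (suc e) e≡d+k cols≈ = begin
    det (suc (suc n)) A    ≈⟨ -‿involutive _ ⟨
    - (- det (suc (suc n)) A) ≈⟨ -‿cong (det-swapAdjacentColumns (suc n) A (suc e)) ⟨
    - det (suc (suc n)) B  ≈⟨ -‿cong det-B≈0 ⟩
    - 0#                   ≈⟨ -0#≈0# ⟩
    0#                     ∎
    where
    B : Matrix (suc (suc n))
    B = replaceAdjacentColumns A (suc e) (column A (suc (suc e))) (column A (inject₁ (suc e)))
    e≡d+k′ : toℕ e ≡ d ℕ.+ toℕ k
    e≡d+k′ = ℕₚ.suc-injective e≡d+k
    B-at-k : ∀ i → B i k ≡ A i k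
    B-at-k i = replaceAdjacentColumns-≢ A (suc e) _ _ i k
      (λ eq → ℕₚ.m≢1+n+m (toℕ k) (≡.trans (≡.cong toℕ eq)
                (≡.trans (toℕ-inject₁ (suc e)) e≡d+k)))
      (λ eq → ℕₚ.m≢1+n+m (toℕ k) {suc d} (≡.trans (≡.cong toℕ eq) (≡.cong suc e≡d+k)))
    det-B≈0 : det (suc (suc n)) B ≈ 0#
    det-B≈0 = det-equalColumnsAtDistance d B k (inject₁ e)
      (≡.trans (toℕ-inject₁ e) e≡d+k′)
      (λ i → trans (reflexive (B-at-k i))
               (trans (cols≈ i)
                 (reflexive (≡.sym (replaceAdjacentColumns-inject₁ A (suc e) _ _ i)))))

  det-equalColumns< : ∀ n (A : Matrix n) (k e : Fin n) → toℕ k < toℕ e →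
    (∀ i → A i k ≈ A i e) → det n A ≈ 0#
  det-equalColumns< (suc n) A k (suc e) k<e cols≈ =
    det-equalColumnsAtDistance (toℕ e ∸ toℕ k) A k e
      (≡.sym (ℕₚ.m∸n+n≡m (s≤s⁻¹ k<e))) cols≈

  det-equalColumns : ∀ n (A : Matrix n) (k e : Fin n) → k ≢ e →
    (∀ i → A i k ≈ A i e) → det n A ≈ 0#
  det-equalColumns n A k e k≢e cols≈ with ℕₚ.<-cmp (toℕ k) (toℕ e)
  ... | tri< k<e _ _ = det-equalColumns< n A k e k<e cols≈
  ... | tri≈ _ k≡e _ = contradiction (toℕ-injective k≡e) k≢e
  ... | tri> _ _ e<k = det-equalColumns< n A e k e<k (sym ∘ cols≈)

  det-addColumnCombination : ∀ n (A A′ : Matrix n) (k : Fin n) x m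
    (y : Fin m → Carrier) (e : Fin m → Fin n) → (∀ s → e s ≢ k) →
    (∀ i → A′ i k ≈ x * A i k + ΣFin m (λ s → y s * A i (e s))) →
    SameOutsideColumn k A′ A → det n A′ ≈ x * det n A
  det-addColumnCombination n A A′ k x zero y e _ colₖ A′~A = begin
    det n A′                   ≈⟨ det-linearInColumn n A′ A A k x 0#
                                    (λ i → trans (colₖ i) (+-congˡ (sym (zeroˡ _)))) A′~A A′~A ⟩
    x * det n A + 0# * det n A ≈⟨ trans (+-congˡ (zeroˡ _)) (+-identityʳ _) ⟩
    x * det n A                ∎
  det-addColumnCombination n A A′ k x (suc m) y e e≢k colₖ A′~A = begin
    det n A′                     ≈⟨ det-linearInColumn n A′ D C k 1# (y zero) colₖ′
                                      (outside-replaced D′) (outside-replaced (column A (e zero))) ⟩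
    1# * det n D + y zero * det n C
      ≈⟨ +-cong (trans (*-identityˡ _) det-D) (trans (*-congˡ det-C≈0) (zeroʳ _)) ⟩
    x * det n A + 0#             ≈⟨ +-identityʳ _ ⟩
    x * det n A                  ∎
    where
    D′ : Fin n → Carrier
    D′ i = x * A i k + ΣFin m (λ s → y (suc s) * A i (e (suc s)))
    D C : Matrix n
    D = replaceColumn A k D′
    C = replaceColumn A k (column A (e zero))
    outside-replaced : ∀ v → SameOutsideColumn k A′ (replaceColumn A k v)
    outside-replaced v i j j≢k =
      trans (A′~A i j j≢k) (reflexive (≡.sym (replaceColumn-≢ A k v i j j≢k)))
    colₖ′ : ∀ i → A′ i k ≈ 1# * D i k + y zero * C i k
    colₖ′ i = begin
      A′ i k  ≈⟨ colₖ i ⟩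
      x * A i k + (y zero * A i (e zero) + ΣFin m (λ s → y (suc s) * A i (e (suc s))))
        ≈⟨ solve 4 (λ a b c d → a :+ (b :* c :+ d) := con 1 :* (a :+ d) :+ b :* c)
                 refl (x * A i k) (y zero) (A i (e zero)) _ ⟩
      1# * D′ i + y zero * A i (e zero)
        ≈⟨ reflexive (≡.sym (≡.cong₂ (λ u v → 1# * u + y zero * v)
             (replaceColumn-≡ A k D′ i) (replaceColumn-≡ A k (column A (e zero)) i))) ⟩
      1# * D i k + y zero * C i k ∎
    det-D : det n D ≈ x * det n A
    det-D = det-addColumnCombination n A D k x m (y ∘ suc) (e ∘ suc) (e≢k ∘ suc)
      (reflexive ∘ replaceColumn-≡ A k D′)
      (λ i j j≢k → reflexive (replaceColumn-≢ A k D′ i j j≢k))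
    det-C≈0 : det n C ≈ 0#
    det-C≈0 = det-equalColumns n C k (e zero) (e≢k zero ∘ ≡.sym) λ i →
      reflexive (≡.trans (replaceColumn-≡ A k _ i)
                         (≡.sym (replaceColumn-≢ A k _ i (e zero) (e≢k zero))))

  prefixProduct : (ℕ → Carrier) → ℕ → Carrier
  prefixProduct x zero    = 1#
  prefixProduct x (suc k) = x k * prefixProduct x k

  -- Replace the columns of R by those of B from left to right: each step is a
  -- column operation multiplying the determinant by the next x_j.
  det-columnTriangular : ∀ n (R B : Matrix n) (x : ℕ → Carrier) (m : Fin n → ℕ)
    (y : ∀ j → Fin (m j) → Carrier) (e : ∀ j → Fin (m j) → Fin n) →
    (∀ j s → toℕ j < toℕ (e j s)) →
    (∀ i j → B i j ≈ x (toℕ j) * R i j + ΣFin (m j) (λ s → y j s * R i (e j s))) →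
    det n B ≈ prefixProduct x n * det n R
  det-columnTriangular n R B x m y e later B≈ =
    trans (det-cong n λ i j → reflexive (≡.sym (mixed-< n i j (toℕ<n j))))
          (det-mixed n ℕₚ.≤-refl)
    where
    mixed : ℕ → Matrix n
    mixed k i j with toℕ j <? k
    ... | yes _ = B i j
    ... | no  _ = R i j
    mixed-< : ∀ k i j → toℕ j < k → mixed k i j ≡ B i j
    mixed-< k i j j<k with toℕ j <? k
    ... | yes _   = ≡.refl
    ... | no  j≮k = contradiction j<k j≮k
    mixed-≮ : ∀ k i j → ¬ toℕ j < k → mixed k i j ≡ R i j
    mixed-≮ k i j j≮k with toℕ j <? k
    ... | yes j<k = contradiction j<k j≮k
    ... | no  _   = ≡.refl
    det-mixed : ∀ k → k ≤ n → det n (mixed k) ≈ prefixProduct x k * det n R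
    det-mixed zero _ =
      trans (det-cong n λ i j → reflexive (mixed-≮ zero i j λ ())) (sym (*-identityˡ _))
    det-mixed (suc k) k<n = begin
      det n (mixed (suc k))
        ≈⟨ det-addColumnCombination n (mixed k) (mixed (suc k)) col (x k) (m col) (y col) (e col)
             (λ s eq → ℕₚ.<-irrefl (≡.cong toℕ (≡.sym eq)) (later col s))
             colₖ outside ⟩
      x k * det n (mixed k)               ≈⟨ *-congˡ (det-mixed k (ℕₚ.<⇒≤ k<n)) ⟩
      x k * (prefixProduct x k * det n R) ≈⟨ *-assoc _ _ _ ⟨
      prefixProduct x (suc k) * det n R   ∎
      where
      col : Fin n
      col = fromℕ< k<n
      col≡k : toℕ col ≡ k
      col≡k = toℕ-fromℕ< k<n
      colₖ : ∀ i → mixed (suc k) i col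
        ≈ x k * mixed k i col + ΣFin (m col) (λ s → y col s * mixed k i (e col s))
      colₖ i = begin
        mixed (suc k) i col
          ≈⟨ reflexive (mixed-< (suc k) i col (ℕₚ.≤-reflexive (≡.cong suc col≡k))) ⟩
        B i col
          ≈⟨ B≈ i col ⟩
        x (toℕ col) * R i col + ΣFin (m col) (λ s → y col s * R i (e col s))
          ≈⟨ +-cong (*-cong (reflexive (≡.cong x col≡k))
                            (reflexive (≡.sym (mixed-≮ k i col (ℕₚ.<-irrefl col≡k)))))
                    (ΣFin-cong (m col) λ s → *-congˡ (reflexive (≡.sym (mixed-≮ k i (e col s)
                       (λ lt → ℕₚ.<-asym lt (≡.subst (_< toℕ (e col s)) col≡k (later col s))))))) ⟩
        x k * mixed k i col + ΣFin (m col) (λ s → y col s * mixed k i (e col s)) ∎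
      outside : SameOutsideColumn col (mixed (suc k)) (mixed k)
      outside i j j≢col = reflexive (Sum.[ bothFromB , bothFromR ]′ (ℕₚ.<-≤-connex (toℕ j) k))
        where
        bothFromB : toℕ j < k → mixed (suc k) i j ≡ mixed k i j
        bothFromB j<k = ≡.trans (mixed-< (suc k) i j (ℕₚ.m<n⇒m<1+n j<k))
                                (≡.sym (mixed-< k i j j<k))
        bothFromR : k ≤ toℕ j → mixed (suc k) i j ≡ mixed k i j
        bothFromR k≤j = ≡.trans (mixed-≮ (suc k) i j j≮1+k)
                                (≡.sym (mixed-≮ k i j (ℕₚ.≤⇒≯ k≤j)))
          where
          j≮1+k : ¬ toℕ j < suc k
          j≮1+k j<1+k = j≢col (toℕ-injective
            (≡.trans (ℕₚ.≤-antisym (s≤s⁻¹ j<1+k) k≤j) (≡.sym col≡k)))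

  prefixProduct-telescoping : ∀ (f : ℕ → Carrier) n → (∀ p → p ≤ n → ¬ f p ≈ 0#) →
    ∀ k → k ≤ n → prefixProduct (λ j → f (n ∸ suc j) * f (n ∸ j) ⁻¹) k ≈ f (n ∸ k) * f n ⁻¹
  prefixProduct-telescoping f n f≉0 zero _ = sym (⁻¹-inverse (f n) (f≉0 n ℕₚ.≤-refl))
  prefixProduct-telescoping f n f≉0 (suc k) k<n = begin
    (f (n ∸ suc k) * f (n ∸ k) ⁻¹) * prefixProduct _ k
      ≈⟨ *-congˡ (prefixProduct-telescoping f n f≉0 k (ℕₚ.<⇒≤ k<n)) ⟩
    (f (n ∸ suc k) * f (n ∸ k) ⁻¹) * (f (n ∸ k) * f n ⁻¹)
      ≈⟨ solve 4 (λ a b c d → (a :* b) :* (c :* d) := a :* ((c :* b) :* d))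
               refl (f (n ∸ suc k)) (f (n ∸ k) ⁻¹) (f (n ∸ k)) (f n ⁻¹) ⟩
    f (n ∸ suc k) * ((f (n ∸ k) * f (n ∸ k) ⁻¹) * f n ⁻¹)
      ≈⟨ *-congˡ (*-congʳ (⁻¹-inverse _ (f≉0 (n ∸ k) (ℕₚ.m∸n≤m n k)))) ⟩
    f (n ∸ suc k) * (1# * f n ⁻¹)  ≈⟨ *-congˡ (*-identityˡ _) ⟩
    f (n ∸ suc k) * f n ⁻¹         ∎

-- The index arithmetic behind the Jacobi–Trudi matrix:
-- (λ + j − i) + (n−1−j) + b = λ + (n−1−i) + b, with a = n−1−j and c = n−1−i.
shiftedIndex : ∀ l i j a b c → j ℕ.+ a ≡ i ℕ.+ c →
  + l ℤ.+ + j ℤ.- + i ℤ.+ + (a ℕ.+ b) ≡ + (l ℕ.+ (c ℕ.+ b))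
shiftedIndex l i j a b c j+a≡i+c = begin
  + l ℤ.+ + j ℤ.- + i ℤ.+ (+ a ℤ.+ + b)
    ≡⟨ regroup (+ l) (+ j) (+ i) (+ a) (+ b) (+ c) ⟩
  + (l ℕ.+ (c ℕ.+ b)) ℤ.+ (+ (j ℕ.+ a) ℤ.- + (i ℕ.+ c))
    ≡⟨ ≡.cong (λ t → + (l ℕ.+ (c ℕ.+ b)) ℤ.+ (+ t ℤ.- + (i ℕ.+ c))) j+a≡i+c ⟩
  + (l ℕ.+ (c ℕ.+ b)) ℤ.+ (+ (i ℕ.+ c) ℤ.- + (i ℕ.+ c))
    ≡⟨ ≡.cong (λ t → + (l ℕ.+ (c ℕ.+ b)) ℤ.+ t) (ℤₚ.+-inverseʳ (+ (i ℕ.+ c))) ⟩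
  + (l ℕ.+ (c ℕ.+ b)) ℤ.+ + 0  ≡⟨ ℤₚ.+-identityʳ _ ⟩
  + (l ℕ.+ (c ℕ.+ b))         ∎
  where
  open ≡.≡-Reasoning
  regroup : ∀ L J I A B C → L ℤ.+ J ℤ.- I ℤ.+ (A ℤ.+ B) ≡ (L ℤ.+ (C ℤ.+ B)) ℤ.+ ((J ℤ.+ A) ℤ.- (I ℤ.+ C))
  regroup = ℤ-Solver.solve-∀

m+[n∸1+m]≡pred[n] : ∀ {m n} → m < n → m ℕ.+ (n ∸ suc m) ≡ ℕ.pred n
m+[n∸1+m]≡pred[n] m<n = ≡.cong ℕ.pred (ℕₚ.m+[n∸m]≡n m<n)

module Jacobi-Trudi {c ℓ} (F : DField c ℓ) (a b c′ d q ξ : DField.Carrier F) where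
  open DField F hiding (zero)
  open Theory F using (ΣFin; sgn; det)
  open Theory.Model F a b c′ d q using (Z; Zℤ; hankel; K; headSeq)
  open Determinant F
  open import Algebra.Solver.Ring.NaturalCoefficients.Default commutativeSemiring
  open import Relation.Binary.Reasoning.Setoid setoid

  H : ℕ → Carrier
  H = hankel ξ

  headMatrix : ∀ p → ℤ → Matrix p
  headMatrix p m r s = Zℤ ξ (headSeq p m r ℤ.+ + ((p ∸ suc (toℕ r)) ℕ.+ (p ∸ suc (toℕ s))))

  headCoefficient : ∀ p → Fin p → Carrier
  headCoefficient p s = sgn (suc (toℕ s)) * det p (minor (headMatrix (suc p) (+ 0)) (suc s)) * H (suc p) ⁻¹

  -- Expanding along the first row, the only row that depends on m; the
  -- cofactor of its first entry is the Hankel determinant H p′.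
  K-headSeq-expansion : ∀ {p p′} → p ≡ suc p′ → ∀ m →
    K ξ p (headSeq p m)
      ≈ (H p′ * H p ⁻¹) * Zℤ ξ (m ℤ.+ + (p′ ℕ.+ p′))
        + ΣFin p′ (λ s → headCoefficient p′ s * Zℤ ξ (m ℤ.+ + (p′ ℕ.+ (p′ ∸ suc (toℕ s)))))
  K-headSeq-expansion {p′ = p′} ≡.refl m = begin
    (1# * (X * H p′) + ΣFin p′ (λ s → sgn (suc (toℕ s)) * (Y s * M s))) * H⁻¹
      ≈⟨ distribʳ H⁻¹ _ _ ⟩
    (1# * (X * H p′)) * H⁻¹ + ΣFin p′ (λ s → sgn (suc (toℕ s)) * (Y s * M s)) * H⁻¹
      ≈⟨ +-cong (solve 3 (λ x h h⁻¹ → (con 1 :* (x :* h)) :* h⁻¹ := (h :* h⁻¹) :* x)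
                       refl X (H p′) H⁻¹)
                (trans (ΣFin-*ʳ p′ _ H⁻¹) (ΣFin-cong p′ λ s →
                   solve 4 (λ σ y m h⁻¹ → (σ :* (y :* m)) :* h⁻¹ := (σ :* m :* h⁻¹) :* y)
                         refl (sgn (suc (toℕ s))) (Y s) (M s) H⁻¹)) ⟩
    (H p′ * H⁻¹) * X + ΣFin p′ (λ s → headCoefficient p′ s * Y s) ∎
    where
    H⁻¹ X : Carrier
    H⁻¹ = H (suc p′) ⁻¹
    X = Zℤ ξ (m ℤ.+ + (p′ ℕ.+ p′))
    Y M : Fin p′ → Carrier
    Y s = Zℤ ξ (m ℤ.+ + (p′ ℕ.+ (p′ ∸ suc (toℕ s))))
    M s = det p′ (minor (headMatrix (suc p′) (+ 0)) (suc s))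

  module _ (n : ℕ) (λ′ : Fin n → ℕ) where

    numerator : Matrix n
    numerator i j = Z ξ (λ′ i ℕ.+ ((n ∸ suc (toℕ i)) ℕ.+ (n ∸ suc (toℕ j))))

    jacobiTrudiMatrix : Matrix n
    jacobiTrudiMatrix i j =
      K ξ (n ∸ toℕ j) (headSeq (n ∸ toℕ j) (+ λ′ i ℤ.+ + toℕ j ℤ.- + toℕ i))

    laterColumn< : (j : Fin n) (s : Fin (n ∸ suc (toℕ j))) → toℕ j ℕ.+ suc (toℕ s) < n
    laterColumn< j s = ≡.subst (_≤ n) (ℕₚ.+-comm (suc (toℕ s)) (suc (toℕ j)))
      (ℕₚ.m≤o∸n⇒m+n≤o (suc (toℕ s)) (toℕ<n j) (toℕ<n s))

    laterColumn : (j : Fin n) → Fin (n ∸ suc (toℕ j)) → Fin n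
    laterColumn j s = fromℕ< (laterColumn< j s)

    laterColumn-> : ∀ j s → toℕ j < toℕ (laterColumn j s)
    laterColumn-> j s = ≡.subst (toℕ j <_) (≡.sym (toℕ-fromℕ< (laterColumn< j s)))
      (ℕₚ.m<m+n (toℕ j) (s≤s z≤n))

    jacobiTrudiMatrix-column : ∀ i j → jacobiTrudiMatrix i j
      ≈ (H (n ∸ suc (toℕ j)) * H (n ∸ toℕ j) ⁻¹) * numerator i j
        + ΣFin (n ∸ suc (toℕ j)) (λ s → headCoefficient _ s * numerator i (laterColumn j s))
    jacobiTrudiMatrix-column i j = begin
      jacobiTrudiMatrix i j
        ≈⟨ K-headSeq-expansion (ℕₚ.+-∸-assoc 1 (toℕ<n j)) _ ⟩
      (H p′ * H (n ∸ toℕ j) ⁻¹) * Zℤ ξ (μ ℤ.+ + (p′ ℕ.+ p′))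
        + ΣFin p′ (λ s → headCoefficient p′ s * Zℤ ξ (μ ℤ.+ + (p′ ℕ.+ (p′ ∸ suc (toℕ s)))))
        ≈⟨ +-cong (*-congˡ (reflexive (≡.cong (Zℤ ξ) (shifted p′))))
                  (ΣFin-cong p′ λ s → *-congˡ (reflexive (≡.cong (Zℤ ξ)
                     (≡.trans (shifted (p′ ∸ suc (toℕ s))) (≡.cong (λ t → + (λ′ i ℕ.+ (rowOffset ℕ.+ t)))
                        (≡.trans (ℕₚ.∸-+-assoc n (suc (toℕ j)) (suc (toℕ s)))
                           (≡.cong (λ t → n ∸ suc t) (≡.sym (toℕ-fromℕ< (laterColumn< j s)))))))))) ⟩
      (H p′ * H (n ∸ toℕ j) ⁻¹) * numerator i j
        + ΣFin p′ (λ s → headCoefficient p′ s * numerator i (laterColumn j s)) ∎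
      where
      p′ rowOffset : ℕ
      p′ = n ∸ suc (toℕ j)
      rowOffset = n ∸ suc (toℕ i)
      μ : ℤ
      μ = + λ′ i ℤ.+ + toℕ j ℤ.- + toℕ i
      shifted : ∀ t → μ ℤ.+ + (p′ ℕ.+ t) ≡ + (λ′ i ℕ.+ (rowOffset ℕ.+ t))
      shifted t = shiftedIndex (λ′ i) (toℕ i) (toℕ j) p′ t rowOffset
        (≡.trans (m+[n∸1+m]≡pred[n] (toℕ<n j)) (≡.sym (m+[n∸1+m]≡pred[n] (toℕ<n i))))

    K≈det-jacobiTrudiMatrix : (∀ p → p ≤ n → ¬ (H p ≈ 0#)) →
      K ξ n (λ i → + λ′ i) ≈ det n jacobiTrudiMatrix
    K≈det-jacobiTrudiMatrix H≉0 = sym (begin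
      det n jacobiTrudiMatrix
        ≈⟨ det-columnTriangular n numerator jacobiTrudiMatrix (λ j → H (n ∸ suc j) * H (n ∸ j) ⁻¹)
             (λ j → n ∸ suc (toℕ j)) (λ j → headCoefficient _) laterColumn laterColumn->
             jacobiTrudiMatrix-column ⟩
      prefixProduct (λ j → H (n ∸ suc j) * H (n ∸ j) ⁻¹) n * det n numerator
        ≈⟨ *-congʳ (prefixProduct-telescoping H n H≉0 n ℕₚ.≤-refl) ⟩
      (H (n ∸ n) * H n ⁻¹) * det n numerator
        ≈⟨ *-congʳ (*-congʳ (reflexive (≡.cong H (ℕₚ.n∸n≡0 n)))) ⟩
      (1# * H n ⁻¹) * det n numerator
        ≈⟨ trans (*-congʳ (*-identityˡ _)) (*-comm _ _) ⟩
      det n numerator * H n ⁻¹ ∎)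

corollary5p2 : ∀ {c ℓ} (F : DField c ℓ) → CharZero F →
    let open DField F in
    (a b c' d q ξ : Carrier) →
    ¬ (q ≈ 0#) →
    ¬ ((1# - q) ≈ 0#) →
    (∀ (m : ℤ) → ¬ ((1# - Theory._^ℤ_ F q m * (a * b * c' * d)) ≈ 0#)) →
    (∀ (k : ℕ) → ¬ ((1# - Theory._^_ F q k * (a * c')) ≈ 0#)) →
    (∀ (k : ℕ) → ¬ ((1# - Theory._^_ F q k * (b * d)) ≈ 0#)) →
    (n : ℕ) → (λ' : Fin n → ℕ) → IsPartition n λ' →
    (∀ (p : ℕ) → p ≤ n → ¬ (Theory.Model.hankel F a b c' d q ξ p ≈ 0#)) →
    Theory.Model.K F a b c' d q ξ n (λ i → + λ' i)
      ≈ Theory.det F n (λ i j →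
          Theory.Model.K F a b c' d q ξ (n ∸ toℕ j)
            (Theory.Model.headSeq F a b c' d q (n ∸ toℕ j)
              (+ λ' i ℤ.+ + toℕ j ℤ.- + toℕ i)))
corollary5p2 F _ a b c' d q ξ _ _ _ _ _ n λ' _ H≉0 =
  Jacobi-Trudi.K≈det-jacobiTrudiMatrix F a b c' d q ξ n λ' H≉0
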